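{- Let $q$ be a prime power. In $\Lambda_{5,q}$ there is a cycle of type $(u_1,v_1,\dots,u_5,v_5)$ with $(v_2+v_3)(v_1+v_5)\ne0$ and $v_1+v_2=0$ if and only if there exist $b,c,r\in\mathbb{F}_q^*$ with $b\notin\{ -c,-2c\}$ such that $v_1=-b$, $v_2=b$, $v_3=c$, $v_4=-b-2c$, $v_5=b+c$ and $u_1=cr$, $u_2=-(b+2c)r$, $u_3=(b+c)r$, $u_4=-br$, $u_5=br$.
   Context: For a prime power $q$ and integer $k\ge2$, $\Lambda_{k,q}$ is the bipartite graph with vertex set $L_k\cup R_k$ (regarded as disjoint), where $L_k$ is the set of vectors $[l]=(l_0,\dots,l_k)\in\mathbb{F}_q^{k+1}$ with $l_1=l_2$ and $R_k$ the set of vectors $\langle r\rangle=(r_0,\dots,r_k)\in\mathbb{F}_q^{k+1}$ with $r_1=0$; edges join only $L_k$ to $R_k$, and $[l]\sim\langle r\rangle$ iff for every $2\le i\le k$: $l_i+r_i=r_0l_{i-2}$ if $i\equiv2,3\pmod4$, and $l_i+r_i=l_0r_{i-2}$ if $i\equiv0,1\pmod4$. A cycle of length $2n$ through the edge joining the two all-zero vectors is written $[l^{(1)}],\langle r^{(1)}\rangle,\dots,[l^{(n)}],\langle r^{(n)}\rangle$ (distinct vertices, consecutive ones adjacent, $\langle r^{(n)}\rangle\sim[l^{(1)}]$) with $[l^{(1)}]$ and $\langle r^{(1)}\rangle$ the all-zero vectors. Put $x_i=l^{(i)}_0$, $y_i=r^{(i)}_0$ ($1\le i\le n$), $x_{n+1}=y_{n+1}=0$,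 $u_i=x_{i+1}-x_i$, $v_i=y_{i+1}-y_i$; the tuple $(u_1,v_1,\dots,u_n,v_n)$ is the type of the cycle, and "there is a cycle of type $\epsilon$" means such a cycle with type $\epsilon$ exists. -}

module Defs where

open import Data.Nat as ℕ using (ℕ; zero; suc; _%_)
open import Data.Nat.Primality using (Prime)
open import Data.Fin using (Fin; toℕ; zero; suc)
open import Data.Vec using (Vec; lookup; replicate)
open import Data.Product using (Σ; ∃; _×_)
open import Data.Sum using (_⊎_)
open import Function.Bundles using (_↔_)
open import Relation.Nullary using (¬_)
open import Relation.Binary.PropositionalEquality using (_≡_; _≢_)
open import Algebra.Structures using (IsCommutativeRing)

record FiniteField : Set₁ where
  infixl 6 _+_
  infixl 7 _*_
  infix  8 -_
  infixl 6 _-_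
  field
    Carrier    : Set
    _+_ _*_    : Carrier → Carrier → Carrier
    -_         : Carrier → Carrier
    0# 1#      : Carrier
    isCommutativeRing : IsCommutativeRing _≡_ _+_ _*_ -_ 0# 1#
    0≢1        : 0# ≢ 1#
    inverse    : ∀ x → x ≢ 0# → Σ Carrier (λ y → x * y ≡ 1#)
    q          : ℕ
    enumeration : Carrier ↔ Fin q
    primePower : Σ ℕ (λ p → Σ ℕ (λ m → Prime p × q ≡ p ℕ.^ suc m))

  _-_ : Carrier → Carrier → Carrier
  x - y = x + (- y)

module Lambda (F : FiniteField) where
  open FiniteField F

  Vect : ℕ → Set
  Vect k = Vec Carrier (suc k)

  InL : ∀ {k} → Vect k → Set
  InL {k} l = ∀ (i j : Fin (suc k)) → toℕ i ≡ 1 → toℕ j ≡ 2 → lookup l i ≡ lookup l j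

  InR : ∀ {k} → Vect k → Set
  InR {k} r = ∀ (i : Fin (suc k)) → toℕ i ≡ 1 → lookup r i ≡ 0#

  Class23 : ℕ → Set
  Class23 n = (n % 4 ≡ 2) ⊎ (n % 4 ≡ 3)

  Adj : ∀ {k} → Vect k → Vect k → Set
  Adj {k} l r = ∀ (i j : Fin (suc k)) → toℕ i ≡ 2 ℕ.+ toℕ j →
      (Class23 (toℕ i) → lookup l i + lookup r i ≡ lookup r zero * lookup l j)
    × (¬ Class23 (toℕ i) → lookup l i + lookup r i ≡ lookup l zero * lookup r j)

  next : ∀ {n} → (Fin n → Carrier) → Fin n → Carrier
  next {suc zero}    f zero    = 0#
  next {suc (suc n)} f zero    = f (suc zero)
  next {suc (suc n)} f (suc i) = next (λ j → f (suc j)) i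

  prevIdx : ∀ {n} → Fin n → Fin n
  prevIdx {suc n} zero    = Data.Fin.fromℕ n
  prevIdx {suc n} (suc i) = Data.Fin.inject₁ i

  -- a cycle [l⁽¹⁾],⟨r⁽¹⁾⟩,…,[l⁽ⁿ⁾],⟨r⁽ⁿ⁾⟩ of length 2n in Λ_{k,q}
  -- through the edge joining the two all-zero vectors
  record Cycle (k n : ℕ) : Set where
    field
      ls : Fin n → Vect k
      rs : Fin n → Vect k
      ls-L : ∀ i → InL (ls i)
      rs-R : ∀ i → InR (rs i)
      ls-distinct : ∀ i j → ls i ≡ ls j → i ≡ j
      rs-distinct : ∀ i j → rs i ≡ rs j → i ≡ j
      adj-lr : ∀ i → Adj (ls i) (rs i)
      adj-rl : ∀ i → Adj (ls i) (rs (prevIdx i))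
      first-zero : Σ (Fin n) (λ i₀ → toℕ i₀ ≡ 0 × ls i₀ ≡ replicate _ 0# × rs i₀ ≡ replicate _ 0#)

    x y : Fin n → Carrier
    x i = lookup (ls i) zero
    y i = lookup (rs i) zero

    u v : Fin n → Carrier
    u i = next x i - x i
    v i = next y i - y i

  HasCycleOfType : (k n : ℕ) → (Fin n → Carrier) → (Fin n → Carrier) → Set
  HasCycleOfType k n u v =
    Σ (Cycle k n) (λ C → (∀ i → Cycle.u C i ≡ u i) × (∀ i → Cycle.v C i ≡ v i))

{-# OPTIONS --safe #-}

-- A vertex adjacent to a given one is determined by its own first coordinate, so a cycle
-- through the zero edge is the walk from the origin fixed by its positions xᵢ = l⁽ⁱ⁾₀,
-- yᵢ = r⁽ⁱ⁾₀, and it closes exactly when the last four coordinates of the walk vanish. With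
-- x₁ = y₁ = 0 and y₃ = 0 (that is v₁ + v₂ = 0) the closing conditions read Σ yᵢuᵢ = Σ yᵢ²uᵢ =
-- Σ yᵢ(xᵢ₊₁² − xᵢ²) = 0 and y₂u₂((y₄ − y₂)u₄ − y₂u₃) = 0, where y₂u₂ ≠ 0 as otherwise r⁽³⁾ = r⁽¹⁾.
-- Under (v₂ + v₃)(v₁ + v₅) ≠ 0 they force u₄ = y₂r, u₃ = (y₄ − y₂)r, y₅ = y₂ − y₄, u₁ = y₄r and
-- u₂ = (y₂ − 2y₄)r for some r ≠ 0: the stated type with b = −y₂, c = y₄. Conversely, for
-- admissible b, c, r the walk with these positions is a cycle.

module Submission where

open import Defs
open import Data.Fin using (Fin; #_)
open import Data.Product using (Σ; _×_)
open import Function.Bundles using (_⇔_)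
open import Relation.Binary.PropositionalEquality using (_≡_; _≢_)

open import Level using (Level)
open import Algebra.Bundles using (CommutativeRing)
open import Algebra.Bundles.Raw using (RawRing)
open import Algebra.Solver.Ring.AlmostCommutativeRing
  using (_-Raw-AlmostCommutative⟶_; fromCommutativeRing)
open import Data.Empty using (⊥-elim)
open import Data.Fin using (zero; suc; inject₁; fromℕ)
open import Data.Integer as ℤ using (ℤ; +_; -[1+_]; _⊖_; _◃_; sign; ∣_∣)
import Data.Integer.Properties as ℤ
open import Data.Maybe using (Maybe; just; nothing)
open import Data.Nat as ℕ using (ℕ; zero; suc)
import Data.Nat.Properties as ℕ
open import Data.Product using (_,_; proj₁; proj₂)
open import Data.Sign as Sign using (Sign)
open import Data.Sum using (inj₁; inj₂)
open import Data.Vec using (Vec; []; _∷_; replicate; lookup)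
open import Data.Vec.Properties using (lookup-replicate)
open import Data.Vec.Relation.Binary.Pointwise.Inductive using (Pointwise-≡⇒≡; []; _∷_)
open import Function.Bundles using (mk⇔)
open import Relation.Nullary using (yes; no)
import Relation.Binary.PropositionalEquality as ≡

module IntegerCoefficients {c ℓ : Level} (R : CommutativeRing c ℓ) where
  open CommutativeRing R
  -- With the type-checking optimised multiple, ⟦ + 0 ⟧ℤ and ⟦ + 1 ⟧ℤ are 0# and 1# by definition,
  -- so the solver's constants match the literals in goals.
  open import Algebra.Properties.Semiring.Mult.TCOptimised semiring
    using (×-homo-+; ×1-homo-*; 1+×) renaming (_×_ to _×ₙ_)
  open import Algebra.Properties.Ring ring using (-‿distribˡ-*; -‿distribʳ-*)
  open import Algebra.Properties.AbelianGroup +-abelianGroup using (⁻¹-∙-comm)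
  open import Algebra.Properties.Group +-group using (⁻¹-involutive; ε⁻¹≈ε)
  open import Relation.Binary.Reasoning.Setoid setoid

  ⟦_⟧ℤ : ℤ → Carrier
  ⟦ + n ⟧ℤ      = n ×ₙ 1#
  ⟦ -[1+ n ] ⟧ℤ = - (suc n ×ₙ 1#)

  private
    signed : Sign → Carrier → Carrier
    signed Sign.+ x = x
    signed Sign.- x = - x

    signed-cong : ∀ s {x y} → x ≈ y → signed s x ≈ signed s y
    signed-cong Sign.+ x≈y = x≈y
    signed-cong Sign.- x≈y = -‿cong x≈y

    signed-* : ∀ s t x y → signed (s Sign.* t) (x * y) ≈ signed s x * signed t y
    signed-* Sign.+ Sign.+ x y = refl
    signed-* Sign.+ Sign.- x y = -‿distribʳ-* x y
    signed-* Sign.- Sign.+ x y = -‿distribˡ-* x y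
    signed-* Sign.- Sign.- x y = begin
      x * y       ≈⟨ ⁻¹-involutive (x * y) ⟨
      - - (x * y) ≈⟨ -‿cong (-‿distribˡ-* x y) ⟩
      - (- x * y) ≈⟨ -‿distribʳ-* (- x) y ⟩
      - x * - y   ∎

    ⟦⟧ℤ-signed : ∀ i → ⟦ i ⟧ℤ ≈ signed (sign i) (∣ i ∣ ×ₙ 1#)
    ⟦⟧ℤ-signed (+ n)    = refl
    ⟦⟧ℤ-signed -[1+ n ] = refl

    ◃-homo : ∀ s n → ⟦ s ◃ n ⟧ℤ ≈ signed s (n ×ₙ 1#)
    ◃-homo Sign.+ zero    = refl
    ◃-homo Sign.- zero    = sym ε⁻¹≈ε
    ◃-homo Sign.+ (suc n) = refl
    ◃-homo Sign.- (suc n) = refl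

    [a+x]-[a+y]≈x-y : ∀ a x y → (a + x) - (a + y) ≈ x - y
    [a+x]-[a+y]≈x-y a x y = begin
      (a + x) - (a + y)   ≈⟨ +-congˡ (⁻¹-∙-comm a y) ⟨
      (a + x) + (- a - y) ≈⟨ +-congʳ (+-comm a x) ⟩
      (x + a) + (- a - y) ≈⟨ +-assoc x a (- a - y) ⟩
      x + (a + (- a - y)) ≈⟨ +-congˡ (+-assoc a (- a) (- y)) ⟨
      x + ((a - a) - y)   ≈⟨ +-congˡ (+-congʳ (-‿inverseʳ a)) ⟩
      x + (0# - y)        ≈⟨ +-congˡ (+-identityˡ (- y)) ⟩
      x - y               ∎

    ⊖-homo : ∀ m n → ⟦ m ⊖ n ⟧ℤ ≈ m ×ₙ 1# - n ×ₙ 1#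
    ⊖-homo zero    zero    = sym (-‿inverseʳ 0#)
    ⊖-homo zero    (suc n) = sym (+-identityˡ _)
    ⊖-homo (suc m) zero    = sym (trans (+-congˡ ε⁻¹≈ε) (+-identityʳ _))
    ⊖-homo (suc m) (suc n) = begin
      ⟦ suc m ⊖ suc n ⟧ℤ            ≡⟨ ≡.cong ⟦_⟧ℤ (ℤ.[1+m]⊖[1+n]≡m⊖n m n) ⟩
      ⟦ m ⊖ n ⟧ℤ                    ≈⟨ ⊖-homo m n ⟩
      m ×ₙ 1# - n ×ₙ 1#               ≈⟨ [a+x]-[a+y]≈x-y 1# (m ×ₙ 1#) (n ×ₙ 1#) ⟨
      (1# + m ×ₙ 1#) - (1# + n ×ₙ 1#) ≈⟨ +-cong (1+× m 1#) (-‿cong (1+× n 1#)) ⟨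
      suc m ×ₙ 1# - suc n ×ₙ 1#       ∎

    +-homo : ∀ i j → ⟦ i ℤ.+ j ⟧ℤ ≈ ⟦ i ⟧ℤ + ⟦ j ⟧ℤ
    +-homo (+ m)    (+ n)    = ×-homo-+ 1# m n
    +-homo (+ m)    -[1+ n ] = ⊖-homo m (suc n)
    +-homo -[1+ m ] (+ n)    = trans (⊖-homo n (suc m)) (+-comm _ _)
    +-homo -[1+ m ] -[1+ n ] = begin
      - (suc (suc (m ℕ.+ n)) ×ₙ 1#)    ≡⟨ ≡.cong (λ k → - (suc k ×ₙ 1#)) (ℕ.+-suc m n) ⟨
      - ((suc m ℕ.+ suc n) ×ₙ 1#)      ≈⟨ -‿cong (×-homo-+ 1# (suc m) (suc n)) ⟩
      - (suc m ×ₙ 1# + suc n ×ₙ 1#)     ≈⟨ ⁻¹-∙-comm _ _ ⟨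
      - (suc m ×ₙ 1#) + - (suc n ×ₙ 1#) ∎

    *-homo : ∀ i j → ⟦ i ℤ.* j ⟧ℤ ≈ ⟦ i ⟧ℤ * ⟦ j ⟧ℤ
    *-homo i j = begin
      ⟦ (sign i Sign.* sign j) ◃ (∣ i ∣ ℕ.* ∣ j ∣) ⟧ℤ             ≈⟨ ◃-homo (sign i Sign.* sign j) (∣ i ∣ ℕ.* ∣ j ∣) ⟩
      signed (sign i Sign.* sign j) ((∣ i ∣ ℕ.* ∣ j ∣) ×ₙ 1#)     ≈⟨ signed-cong (sign i Sign.* sign j) (×1-homo-* ∣ i ∣ ∣ j ∣) ⟩
      signed (sign i Sign.* sign j) (∣ i ∣ ×ₙ 1# * ∣ j ∣ ×ₙ 1#)     ≈⟨ signed-* (sign i) (sign j) _ _ ⟩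
      signed (sign i) (∣ i ∣ ×ₙ 1#) * signed (sign j) (∣ j ∣ ×ₙ 1#) ≈⟨ *-cong (⟦⟧ℤ-signed i) (⟦⟧ℤ-signed j) ⟨
      ⟦ i ⟧ℤ * ⟦ j ⟧ℤ                                              ∎

    -‿homo : ∀ i → ⟦ ℤ.- i ⟧ℤ ≈ - ⟦ i ⟧ℤ
    -‿homo (+ zero)  = sym ε⁻¹≈ε
    -‿homo (+ suc n) = refl
    -‿homo -[1+ n ]  = sym (⁻¹-involutive _)

    homomorphism : ℤ.+-*-rawRing -Raw-AlmostCommutative⟶ fromCommutativeRing R
    homomorphism = record
      { ⟦_⟧ = ⟦_⟧ℤ ; +-homo = +-homo ; *-homo = *-homo ; -‿homo = -‿homo
      ; 0-homo = refl ; 1-homo = refl }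

    coefficients≟ : ∀ i j → Maybe (⟦ i ⟧ℤ ≈ ⟦ j ⟧ℤ)
    coefficients≟ i j with i ℤ.≟ j
    ... | yes i≡j = just (reflexive (≡.cong ⟦_⟧ℤ i≡j))
    ... | no _    = nothing

  open import Algebra.Solver.Ring ℤ.+-*-rawRing (fromCommutativeRing R) homomorphism coefficients≟ public

  polynomials : ℕ → RawRing _ _
  polynomials n = record
    { Carrier = Polynomial n ; _≈_ = ≡._≡_
    ; _+_ = _:+_ ; _*_ = _:*_ ; -_ = :-_ ; 0# = con (+ 0) ; 1# = con (+ 1) }

-- Stated over a raw ring so that it can be instantiated both in the field and in the solver's
-- polynomial syntax (module P below); the solver then handles walk coordinates directly.
module Coordinates {c ℓ : Level} (R : RawRing c ℓ) where
  open RawRing R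

  private
    infixl 6 _-_
    _-_ : Carrier → Carrier → Carrier
    x - y = x + - y

  origin : Vec Carrier 6
  origin = replicate 6 0#

  lNext : Carrier → Vec Carrier 6 → Vec Carrier 6
  lNext x (y ∷ _ ∷ r ∷ s ∷ t ∷ w ∷ []) = x ∷ p ∷ p ∷ y * p - s ∷ x * r - t ∷ x * s - w ∷ []
    where
    p : Carrier
    p = y * x - r

  rNext : Carrier → Vec Carrier 6 → Vec Carrier 6
  rNext y (x ∷ p ∷ q ∷ a ∷ b ∷ c ∷ []) = y ∷ 0# ∷ r ∷ s ∷ x * r - b ∷ x * s - c ∷ []
    where
    r s : Carrier
    r = y * x - q
    s = y * p - a

  step : Carrier → Carrier → Vec Carrier 6 → Vec Carrier 6
  step x y r = rNext y (lNext x r)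

  -- step, with each new coordinate written as an increment of the old one; normalising walks built
  -- from stepΔ is far cheaper than from step.
  stepΔ : Carrier → Carrier → Vec Carrier 6 → Vec Carrier 6
  stepΔ x′ y′ (y ∷ _ ∷ r ∷ s ∷ t ∷ w ∷ []) = y′ ∷ 0# ∷ r + Δr ∷ s + Δs ∷ t + x′ * Δr ∷ w + x′ * Δs ∷ []
    where
    Δr Δs : Carrier
    Δr = (y′ - y) * x′
    Δs = (y′ - y) * (y * x′ - r)

  walkEnd : (x₂ x₃ x₄ x₅ y₂ y₃ y₄ y₅ : Carrier) → Vec Carrier 6
  walkEnd x₂ x₃ x₄ x₅ y₂ y₃ y₄ y₅ = stepΔ x₅ y₅ (stepΔ x₄ y₄ (stepΔ x₃ y₃ (stepΔ x₂ y₂ origin)))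

  -- Σ yᵢuᵢ, Σ yᵢ²uᵢ and Σ yᵢ(xᵢ₊₁² − xᵢ²) for the positions (0, x₂, …, x₅) and (0, y₂, 0, y₄, y₅).
  balance₁ balance₂ balance₃ : (x₂ x₃ x₄ x₅ y₂ y₄ y₅ : Carrier) → Carrier
  balance₁ x₂ x₃ x₄ x₅ y₂ y₄ y₅ = y₂ * (x₃ - x₂) + y₄ * (x₅ - x₄) - y₅ * x₅
  balance₂ x₂ x₃ x₄ x₅ y₂ y₄ y₅ = y₂ * (y₂ * (x₃ - x₂)) + y₄ * (y₄ * (x₅ - x₄)) - y₅ * (y₅ * x₅)
  balance₃ x₂ x₃ x₄ x₅ y₂ y₄ y₅ = y₂ * (x₃ * x₃ - x₂ * x₂) + y₄ * (x₅ * x₅ - x₄ * x₄) - y₅ * (x₅ * x₅)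

  xs° : (b c r : Carrier) → Fin 5 → Carrier
  xs° b c r = lookup (0# ∷ c * r ∷ - ((b + c) * r) ∷ 0# ∷ - (b * r) ∷ [])

  ys° : (b c : Carrier) → Fin 5 → Carrier
  ys° b c = lookup (0# ∷ - b ∷ 0# ∷ c ∷ - (b + c) ∷ [])

  rs° : (b c r : Carrier) → Fin 5 → Vec Carrier 6
  rs° b c r = lookup (origin ∷ r₂ ∷ r₃ ∷ r₄ ∷ r₅ ∷ [])
    where
    x y : Fin 5 → Carrier
    x = xs° b c r
    y = ys° b c
    r₂ r₃ r₄ r₅ : Vec Carrier 6
    r₂ = step (x (# 1)) (y (# 1)) origin
    r₃ = step (x (# 2)) (y (# 2)) r₂
    r₄ = step (x (# 3)) (y (# 3)) r₃
    r₅ = step (x (# 4)) (y (# 4)) r₄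

  ls° : (b c r : Carrier) → Fin 5 → Vec Carrier 6
  ls° b c r zero    = origin
  ls° b c r (suc i) = lNext (xs° b c r (suc i)) (rs° b c r (inject₁ i))

open ≡ using (refl; sym; trans; cong; cong₂; subst; module ≡-Reasoning)

injective-cons : ∀ {a} {A : Set a} {n} (f : Fin (ℕ.suc n) → A) →
  (∀ j → f zero ≢ f (suc j)) → (∀ i j → f (suc i) ≡ f (suc j) → i ≡ j) → ∀ i j → f i ≡ f j → i ≡ j
injective-cons f fresh injective zero    zero    _   = refl
injective-cons f fresh injective zero    (suc j) f≡f = ⊥-elim (fresh j f≡f)
injective-cons f fresh injective (suc i) zero    f≡f = ⊥-elim (fresh i (sym f≡f))
injective-cons f fresh injective (suc i) (suc j) f≡f = cong suc (injective i j f≡f)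

module Λ₅ (F : FiniteField) where
  open FiniteField F
  open Lambda F

  ring : CommutativeRing _ _
  ring = record { isCommutativeRing = isCommutativeRing }

  open CommutativeRing ring using (+-comm; zeroˡ; zeroʳ; +-group)
  open import Algebra.Properties.Group +-group using (x∙y⁻¹≈ε⇒x≈y; x≈y⇒x∙y⁻¹≈ε; inverseˡ-unique; quasigroup)
  open import Algebra.Properties.Quasigroup quasigroup using (x≈z//y)
  open IntegerCoefficients ring using (Polynomial; solve; _:=_; _:+_; _:*_; _:-_; :-_; con; polynomials)
  open Coordinates (CommutativeRing.rawRing ring)
  module P {n} = Coordinates (polynomials n)
  open ≡-Reasoning

  x+y≡z⇒x≡z-y : ∀ {x y z} → x + y ≡ z → x ≡ z - y
  x+y≡z⇒x≡z-y = x≈z//y _ _ _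

  x+y≡z⇒y≡z-x : ∀ {x y z} → x + y ≡ z → y ≡ z - x
  x+y≡z⇒y≡z-x {x} {y} x+y≡z = x+y≡z⇒x≡z-y (trans (+-comm y x) x+y≡z)

  x-y≡0⇒x≡y : ∀ {x y} → x - y ≡ 0# → x ≡ y
  x-y≡0⇒x≡y = x∙y⁻¹≈ε⇒x≈y _ _

  x≡y⇒x-y≡0 : ∀ {x y} → x ≡ y → x - y ≡ 0#
  x≡y⇒x-y≡0 = x≈y⇒x∙y⁻¹≈ε

  x-y≡z⇒x≡y+z : ∀ {x y z} → x - y ≡ z → x ≡ y + z
  x-y≡z⇒x≡y+z {x} {y} {z} x-y≡z = begin
    x             ≡⟨ solve 2 (λ x y → x := y :+ (x :- y)) refl x y ⟩
    y + (x - y)   ≡⟨ cong (λ w → y + w) x-y≡z ⟩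
    y + z         ∎

  x+[y-x]≡y : ∀ x y → x + (y - x) ≡ y
  x+[y-x]≡y = solve 2 (λ x y → x :+ (y :- x) := y) refl

  [x-y]+y≡x : ∀ x y → (x - y) + y ≡ x
  [x-y]+y≡x = solve 2 (λ x y → (x :- y) :+ y := x) refl

  x*y≡0⇒y≡0 : ∀ {x y} → x ≢ 0# → x * y ≡ 0# → y ≡ 0#
  x*y≡0⇒y≡0 {x} {y} x≢0 xy≡0 with inverse x x≢0
  ... | x⁻¹ , xx⁻¹≡1 = begin
    y                                  ≡⟨ solve 3 (λ x x⁻¹ y → y := x⁻¹ :* (x :* y) :+ (con (+ 1) :- x :* x⁻¹) :* y) refl x x⁻¹ y ⟩
    x⁻¹ * (x * y) + (1# - x * x⁻¹) * y ≡⟨ cong₂ (λ a b → x⁻¹ * a + (1# - b) * y) xy≡0 xx⁻¹≡1 ⟩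
    x⁻¹ * 0# + (1# - 1#) * y           ≡⟨ solve 2 (λ x⁻¹ y → x⁻¹ :* con (+ 0) :+ (con (+ 1) :- con (+ 1)) :* y := con (+ 0)) refl x⁻¹ y ⟩
    0#                                 ∎

  x*y≢0⇒x≢0 : ∀ {x y} → x * y ≢ 0# → x ≢ 0#
  x*y≢0⇒x≢0 {y = y} xy≢0 x≡0 = xy≢0 (trans (cong (_* y) x≡0) (zeroˡ y))

  x*y≢0⇒y≢0 : ∀ {x y} → x * y ≢ 0# → y ≢ 0#
  x*y≢0⇒y≢0 {x} xy≢0 y≡0 = xy≢0 (trans (cong (x *_) y≡0) (zeroʳ x))

  x≢0∧y≢0⇒x*y≢0 : ∀ {x y} → x ≢ 0# → y ≢ 0# → x * y ≢ 0#
  x≢0∧y≢0⇒x*y≢0 x≢0 y≢0 xy≡0 = y≢0 (x*y≡0⇒y≡0 x≢0 xy≡0)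

  multiple-≡0 : ∀ {x k y} → x ≡ k * y → y ≡ 0# → x ≡ 0#
  multiple-≡0 {k = k} x≡ky y≡0 = trans x≡ky (trans (cong (k *_) y≡0) (zeroʳ k))

  combination-≡0 : ∀ {x k y l z} → x ≡ k * y + l * z → y ≡ 0# → z ≡ 0# → x ≡ 0#
  combination-≡0 {k = k} {l = l} x≡ky+lz y≡0 z≡0 = begin
    _               ≡⟨ x≡ky+lz ⟩
    k * _ + l * _   ≡⟨ cong₂ (λ a b → k * a + l * b) y≡0 z≡0 ⟩
    k * 0# + l * 0# ≡⟨ solve 2 (λ k l → k :* con (+ 0) :+ l :* con (+ 0) := con (+ 0)) refl k l ⟩
    0#              ∎

  combination₃-≡0 : ∀ {x k y l z m w} → x ≡ k * y + l * z + m * w → y ≡ 0# → z ≡ 0# → w ≡ 0# → x ≡ 0#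
  combination₃-≡0 {x} {k} {y} {l} {z} {m} {w} x≡ky+lz+mw y≡0 z≡0 w≡0 = combination-≡0
    (trans x≡ky+lz+mw
      (solve 6 (λ k y l z m w → k :* y :+ l :* z :+ m :* w := con (+ 1) :* (k :* y :+ l :* z) :+ m :* w)
             refl k y l z m w))
    (combination-≡0 refl y≡0 z≡0) w≡0

  -x≢0 : ∀ {x} → x ≢ 0# → - x ≢ 0#
  -x≢0 {x} x≢0 -x≡0 = x≢0 (multiple-≡0 (solve 1 (λ x → x := (:- con (+ 1)) :* (:- x)) refl x) -x≡0)

  x≢-y⇒x+y≢0 : ∀ {x y} → x ≢ - y → x + y ≢ 0#
  x≢-y⇒x+y≢0 x≢-y x+y≡0 = x≢-y (inverseˡ-unique _ _ x+y≡0)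

  adj-intro : ∀ (l r : Vect 5) →
    lookup l (# 2) + lookup r (# 2) ≡ lookup r (# 0) * lookup l (# 0) →
    lookup l (# 3) + lookup r (# 3) ≡ lookup r (# 0) * lookup l (# 1) →
    lookup l (# 4) + lookup r (# 4) ≡ lookup l (# 0) * lookup r (# 2) →
    lookup l (# 5) + lookup r (# 5) ≡ lookup l (# 0) * lookup r (# 3) → Adj l r
  adj-intro _ _ e₂ e₃ e₄ e₅ zero                                _ ()
  adj-intro _ _ e₂ e₃ e₄ e₅ (suc zero)                          _ ()
  adj-intro _ _ e₂ e₃ e₄ e₅ (suc (suc zero))                    zero refl =
    (λ _ → e₂) , λ ¬class → ⊥-elim (¬class (inj₁ refl))
  adj-intro _ _ e₂ e₃ e₄ e₅ (suc (suc (suc zero)))              (suc zero) refl =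
    (λ _ → e₃) , λ ¬class → ⊥-elim (¬class (inj₂ refl))
  adj-intro _ _ e₂ e₃ e₄ e₅ (suc (suc (suc (suc zero))))        (suc (suc zero)) refl =
    (λ { (inj₁ ()) ; (inj₂ ()) }) , λ _ → e₄
  adj-intro _ _ e₂ e₃ e₄ e₅ (suc (suc (suc (suc (suc zero))))) (suc (suc (suc zero))) refl =
    (λ { (inj₁ ()) ; (inj₂ ()) }) , λ _ → e₅
  adj-intro _ _ e₂ e₃ e₄ e₅ (suc (suc zero))                    (suc _) ()
  adj-intro _ _ e₂ e₃ e₄ e₅ (suc (suc (suc zero)))              zero ()
  adj-intro _ _ e₂ e₃ e₄ e₅ (suc (suc (suc zero)))              (suc (suc _)) ()
  adj-intro _ _ e₂ e₃ e₄ e₅ (suc (suc (suc (suc zero))))        (suc (suc (suc _))) ()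
  adj-intro _ _ e₂ e₃ e₄ e₅ (suc (suc (suc (suc zero))))        zero ()
  adj-intro _ _ e₂ e₃ e₄ e₅ (suc (suc (suc (suc zero))))        (suc zero) ()
  adj-intro _ _ e₂ e₃ e₄ e₅ (suc (suc (suc (suc (suc zero))))) zero ()
  adj-intro _ _ e₂ e₃ e₄ e₅ (suc (suc (suc (suc (suc zero))))) (suc zero) ()
  adj-intro _ _ e₂ e₃ e₄ e₅ (suc (suc (suc (suc (suc zero))))) (suc (suc zero)) ()
  adj-intro _ _ e₂ e₃ e₄ e₅ (suc (suc (suc (suc (suc zero))))) (suc (suc (suc (suc _)))) ()

  adj-equations : ∀ {l r : Vect 5} → Adj l r →
      lookup l (# 2) + lookup r (# 2) ≡ lookup r (# 0) * lookup l (# 0)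
    × lookup l (# 3) + lookup r (# 3) ≡ lookup r (# 0) * lookup l (# 1)
    × lookup l (# 4) + lookup r (# 4) ≡ lookup l (# 0) * lookup r (# 2)
    × lookup l (# 5) + lookup r (# 5) ≡ lookup l (# 0) * lookup r (# 3)
  adj-equations adj =
      proj₁ (adj (# 2) (# 0) refl) (inj₁ refl)
    , proj₁ (adj (# 3) (# 1) refl) (inj₂ refl)
    , proj₂ (adj (# 4) (# 2) refl) (λ { (inj₁ ()) ; (inj₂ ()) })
    , proj₂ (adj (# 5) (# 3) refl) (λ { (inj₁ ()) ; (inj₂ ()) })

  inL-intro : ∀ (l : Vect 5) → lookup l (# 1) ≡ lookup l (# 2) → InL l
  inL-intro _ e zero                     _                                ()   _
  inL-intro _ e (suc zero)               (suc (suc zero))                 refl refl = e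
  inL-intro _ e (suc zero)               zero                             _    ()
  inL-intro _ e (suc zero)               (suc zero)                       _    ()
  inL-intro _ e (suc zero)               (suc (suc (suc _)))              _    ()
  inL-intro _ e (suc (suc _))            _                                ()   _

  inR-intro : ∀ (r : Vect 5) → lookup r (# 1) ≡ 0# → InR r
  inR-intro _ e zero          ()
  inR-intro _ e (suc zero)    refl = e
  inR-intro _ e (suc (suc _)) ()

  origin-L : InL origin
  origin-L = inL-intro origin refl

  origin-R : InR origin
  origin-R = inR-intro origin refl

  lNext-L : ∀ x r → InL (lNext x r)
  lNext-L x r@(_ ∷ _ ∷ _ ∷ _ ∷ _ ∷ _ ∷ []) = inL-intro (lNext x r) refl

  rNext-R : ∀ y l → InR (rNext y l)
  rNext-R y l@(_ ∷ _ ∷ _ ∷ _ ∷ _ ∷ _ ∷ []) = inR-intro (rNext y l) refl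

  adj-origin : Adj origin origin
  adj-origin = adj-intro origin origin 0+0≡0*0 0+0≡0*0 0+0≡0*0 0+0≡0*0
    where
    0+0≡0*0 : 0# + 0# ≡ 0# * 0#
    0+0≡0*0 = solve 0 (con (+ 0) :+ con (+ 0) := con (+ 0) :* con (+ 0)) refl

  adj-lNext : ∀ x r → Adj (lNext x r) r
  adj-lNext x r@(_ ∷ _ ∷ _ ∷ _ ∷ _ ∷ _ ∷ []) =
    adj-intro (lNext x r) r ([x-y]+y≡x _ _) ([x-y]+y≡x _ _) ([x-y]+y≡x _ _) ([x-y]+y≡x _ _)

  adj-rNext : ∀ y l → Adj l (rNext y l)
  adj-rNext y l@(_ ∷ _ ∷ _ ∷ _ ∷ _ ∷ _ ∷ []) =
    adj-intro l (rNext y l) (x+[y-x]≡y _ _) (x+[y-x]≡y _ _) (x+[y-x]≡y _ _) (x+[y-x]≡y _ _)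

  adj⇒lNext : ∀ {l r : Vect 5} → InL l → Adj l r → l ≡ lNext (lookup l zero) r
  adj⇒lNext {l@(x ∷ p ∷ q ∷ a ∷ b ∷ c ∷ [])} {r@(y ∷ _ ∷ r₂ ∷ s ∷ _ ∷ _ ∷ [])} inL adj
    with adj-equations {l} {r} adj
  ... | e₂ , e₃ , e₄ , e₅ =
    Pointwise-≡⇒≡ (refl ∷ p≡ ∷ q≡ ∷ a≡ ∷ x+y≡z⇒x≡z-y e₄ ∷ x+y≡z⇒x≡z-y e₅ ∷ [])
    where
    q≡ : q ≡ y * x - r₂
    q≡ = x+y≡z⇒x≡z-y e₂
    p≡ : p ≡ y * x - r₂
    p≡ = trans (inL (# 1) (# 2) refl refl) q≡
    a≡ : a ≡ y * (y * x - r₂) - s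
    a≡ = trans (x+y≡z⇒x≡z-y e₃) (cong (λ p → y * p - s) p≡)

  adj⇒rNext : ∀ {l r : Vect 5} → InR r → Adj l r → r ≡ rNext (lookup r zero) l
  adj⇒rNext {l@(x ∷ p ∷ q ∷ a ∷ b ∷ c ∷ [])} {r@(y ∷ _ ∷ r₂ ∷ s ∷ t ∷ w ∷ [])} inR adj
    with adj-equations {l} {r} adj
  ... | e₂ , e₃ , e₄ , e₅ =
    Pointwise-≡⇒≡ (refl ∷ inR (# 1) refl ∷ r≡ ∷ s≡ ∷ t≡ ∷ w≡ ∷ [])
    where
    r≡ : r₂ ≡ y * x - q
    r≡ = x+y≡z⇒y≡z-x e₂
    s≡ : s ≡ y * p - a
    s≡ = x+y≡z⇒y≡z-x e₃
    t≡ : t ≡ x * (y * x - q) - b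
    t≡ = trans (x+y≡z⇒y≡z-x e₄) (cong (λ r → x * r - b) r≡)
    w≡ : w ≡ x * (y * p - a) - c
    w≡ = trans (x+y≡z⇒y≡z-x e₅) (cong (λ s → x * s - c) s≡)

  differ-at : ∀ {v w : Vect 5} k {d} → lookup w k - lookup v k ≡ d → d ≢ 0# → v ≢ w
  differ-at k {d} w-v≡d d≢0 v≡w = d≢0 (trans (sym w-v≡d) (x≡y⇒x-y≡0 (cong (λ z → lookup z k) (sym v≡w))))

  step≡stepΔ : ∀ x y r → step x y r ≡ stepΔ x y r
  step≡stepΔ x y (y₀ ∷ _ ∷ r₀ ∷ s₀ ∷ t₀ ∷ w₀ ∷ []) = Pointwise-≡⇒≡ (refl ∷ refl ∷
      solve 7 (λ x y y₀ r₀ s₀ t₀ w₀ → coordinate (# 2) x y y₀ r₀ s₀ t₀ w₀) refl x y y₀ r₀ s₀ t₀ w₀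
    ∷ solve 7 (λ x y y₀ r₀ s₀ t₀ w₀ → coordinate (# 3) x y y₀ r₀ s₀ t₀ w₀) refl x y y₀ r₀ s₀ t₀ w₀
    ∷ solve 7 (λ x y y₀ r₀ s₀ t₀ w₀ → coordinate (# 4) x y y₀ r₀ s₀ t₀ w₀) refl x y y₀ r₀ s₀ t₀ w₀
    ∷ solve 7 (λ x y y₀ r₀ s₀ t₀ w₀ → coordinate (# 5) x y y₀ r₀ s₀ t₀ w₀) refl x y y₀ r₀ s₀ t₀ w₀
    ∷ [])
    where
    coordinate : ∀ {n} → Fin 6 → (x y y₀ r₀ s₀ t₀ w₀ : Polynomial n) → Polynomial n × Polynomial n
    coordinate k x y y₀ r₀ s₀ t₀ w₀ =
      let r = y₀ ∷ con (+ 0) ∷ r₀ ∷ s₀ ∷ t₀ ∷ w₀ ∷ [] in lookup (P.step x y r) k := lookup (P.stepΔ x y r) k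

  steps≡walkEnd : ∀ x₂ x₃ x₄ x₅ y₂ y₃ y₄ y₅ →
    step x₅ y₅ (step x₄ y₄ (step x₃ y₃ (step x₂ y₂ origin))) ≡ walkEnd x₂ x₃ x₄ x₅ y₂ y₃ y₄ y₅
  steps≡walkEnd x₂ x₃ x₄ x₅ y₂ y₃ y₄ y₅ = step≡stepΔ′ (step≡stepΔ′ (step≡stepΔ′ (step≡stepΔ x₂ y₂ origin)))
    where
    step≡stepΔ′ : ∀ {x y r r′} → r ≡ r′ → step x y r ≡ stepΔ x y r′
    step≡stepΔ′ {x} {y} {r′ = r′} r≡r′ = trans (cong (step x y) r≡r′) (step≡stepΔ x y r′)

  returns-to-origin : ∀ {x₂ x₃ y₂} → y₂ * (x₃ - x₂) ≡ 0# → stepΔ x₃ 0# (stepΔ x₂ y₂ origin) ≡ origin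
  returns-to-origin {x₂} {x₃} {y₂} D≡0 = Pointwise-≡⇒≡ (refl ∷ refl ∷
      multiple-≡0 (solve 3 (λ x₂ x₃ y₂ → r₃ x₂ x₃ y₂ (# 2) := (:- con (+ 1)) :* (y₂ :* (x₃ :- x₂))) refl x₂ x₃ y₂) D≡0
    ∷ multiple-≡0 (solve 3 (λ x₂ x₃ y₂ → r₃ x₂ x₃ y₂ (# 3) := (:- y₂) :* (y₂ :* (x₃ :- x₂))) refl x₂ x₃ y₂) D≡0
    ∷ multiple-≡0 (solve 3 (λ x₂ x₃ y₂ → r₃ x₂ x₃ y₂ (# 4) := (:- (x₂ :+ x₃)) :* (y₂ :* (x₃ :- x₂))) refl x₂ x₃ y₂) D≡0
    ∷ multiple-≡0 (solve 3 (λ x₂ x₃ y₂ → r₃ x₂ x₃ y₂ (# 5) := (:- (x₃ :* y₂)) :* (y₂ :* (x₃ :- x₂))) refl x₂ x₃ y₂) D≡0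
    ∷ [])
    where
    r₃ : ∀ {n} (x₂ x₃ y₂ : Polynomial n) → Fin 6 → Polynomial n
    r₃ x₂ x₃ y₂ = lookup (P.stepΔ x₃ (con (+ 0)) (P.stepΔ x₂ y₂ P.origin))

  increments : ∀ {n} → (Fin n → Carrier) → Fin n → Carrier
  increments x i = next x i - x i

  ParametrisedBy : (b c r : Carrier) (u v : Fin 5 → Carrier) → Set
  ParametrisedBy b c r u v =
      v (# 0) ≡ - b × v (# 1) ≡ b × v (# 2) ≡ c
    × v (# 3) ≡ - b - (c + c) × v (# 4) ≡ b + c
    × u (# 0) ≡ c * r × u (# 1) ≡ - ((b + (c + c)) * r)
    × u (# 2) ≡ (b + c) * r × u (# 3) ≡ - (b * r) × u (# 4) ≡ b * r

  Parametrised : (u v : Fin 5 → Carrier) → Set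
  Parametrised u v = Σ Carrier λ b → Σ Carrier λ c → Σ Carrier λ r →
    b ≢ 0# × c ≢ 0# × r ≢ 0# × b ≢ - c × b ≢ - (c + c) × ParametrisedBy b c r u v

  Parametrised-resp : ∀ {u v u′ v′} → (∀ i → u i ≡ u′ i) → (∀ i → v i ≡ v′ i) → Parametrised u v → Parametrised u′ v′
  Parametrised-resp u≗u′ v≗v′ (b , c , r , b≢0 , c≢0 , r≢0 , b≢-c , b≢-2c , v₀ , v₁ , v₂ , v₃ , v₄ , u₀ , u₁ , u₂ , u₃ , u₄) =
    b , c , r , b≢0 , c≢0 , r≢0 , b≢-c , b≢-2c ,
    along v≗v′ (# 0) v₀ , along v≗v′ (# 1) v₁ , along v≗v′ (# 2) v₂ , along v≗v′ (# 3) v₃ , along v≗v′ (# 4) v₄ ,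
    along u≗u′ (# 0) u₀ , along u≗u′ (# 1) u₁ , along u≗u′ (# 2) u₂ , along u≗u′ (# 3) u₃ , along u≗u′ (# 4) u₄
    where
    along : ∀ {f g : Fin 5 → Carrier} → (∀ i → f i ≡ g i) → ∀ i {z} → f i ≡ z → g i ≡ z
    along f≗g i f≡z = trans (sym (f≗g i)) f≡z

  ParametrisedBy-unique : ∀ {b c r u v u′ v′} → ParametrisedBy b c r u v → ParametrisedBy b c r u′ v′ →
    (∀ i → u i ≡ u′ i) × (∀ i → v i ≡ v′ i)
  ParametrisedBy-unique (v₀ , v₁ , v₂ , v₃ , v₄ , u₀ , u₁ , u₂ , u₃ , u₄)
                        (v₀′ , v₁′ , v₂′ , v₃′ , v₄′ , u₀′ , u₁′ , u₂′ , u₃′ , u₄′) =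
      (λ { zero → trans u₀ (sym u₀′) ; (suc zero) → trans u₁ (sym u₁′) ; (suc (suc zero)) → trans u₂ (sym u₂′)
         ; (suc (suc (suc zero))) → trans u₃ (sym u₃′) ; (suc (suc (suc (suc zero)))) → trans u₄ (sym u₄′) })
    , (λ { zero → trans v₀ (sym v₀′) ; (suc zero) → trans v₁ (sym v₁′) ; (suc (suc zero)) → trans v₂ (sym v₂′)
         ; (suc (suc (suc zero))) → trans v₃ (sym v₃′) ; (suc (suc (suc (suc zero)))) → trans v₄ (sym v₄′) })

  canonical-type : ∀ b c r → ParametrisedBy b c r (increments (xs° b c r)) (increments (ys° b c))
  canonical-type b c r =
      solve 2 (λ b c → P.ys° b c (# 1) :- P.ys° b c (# 0) := :- b) refl b c
    , solve 2 (λ b c → P.ys° b c (# 2) :- P.ys° b c (# 1) := b) refl b c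
    , solve 2 (λ b c → P.ys° b c (# 3) :- P.ys° b c (# 2) := c) refl b c
    , solve 2 (λ b c → P.ys° b c (# 4) :- P.ys° b c (# 3) := :- b :- (c :+ c)) refl b c
    , solve 2 (λ b c → con (+ 0) :- P.ys° b c (# 4) := b :+ c) refl b c
    , solve 3 (λ b c r → P.xs° b c r (# 1) :- P.xs° b c r (# 0) := c :* r) refl b c r
    , solve 3 (λ b c r → P.xs° b c r (# 2) :- P.xs° b c r (# 1) := :- ((b :+ (c :+ c)) :* r)) refl b c r
    , solve 3 (λ b c r → P.xs° b c r (# 3) :- P.xs° b c r (# 2) := (b :+ c) :* r) refl b c r
    , solve 3 (λ b c r → P.xs° b c r (# 4) :- P.xs° b c r (# 3) := :- (b :* r)) refl b c r
    , solve 3 (λ b c r → con (+ 0) :- P.xs° b c r (# 4) := b :* r) refl b c r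

  closing-balance : ∀ {x₂ x₃ x₄ x₅ y₂ y₄ y₅} → lNext 0# (walkEnd x₂ x₃ x₄ x₅ y₂ 0# y₄ y₅) ≡ origin →
      balance₁ x₂ x₃ x₄ x₅ y₂ y₄ y₅ ≡ 0#
    × balance₂ x₂ x₃ x₄ x₅ y₂ y₄ y₅ ≡ 0#
    × balance₃ x₂ x₃ x₄ x₅ y₂ y₄ y₅ ≡ 0#
    × y₂ * (x₃ - x₂) * ((y₄ - y₂) * (x₅ - x₄) - y₂ * (x₄ - x₃)) ≡ 0#
  closing-balance {x₂} {x₃} {x₄} {x₅} {y₂} {y₄} {y₅} closed =
      trans (solve 7 (λ x₂ x₃ x₄ x₅ y₂ y₄ y₅ → P.balance₁ x₂ x₃ x₄ x₅ y₂ y₄ y₅ := end x₂ x₃ x₄ x₅ y₂ y₄ y₅ (# 1))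
                     refl x₂ x₃ x₄ x₅ y₂ y₄ y₅) (coordinate (# 1))
    , trans (solve 7 (λ x₂ x₃ x₄ x₅ y₂ y₄ y₅ → P.balance₂ x₂ x₃ x₄ x₅ y₂ y₄ y₅ := end x₂ x₃ x₄ x₅ y₂ y₄ y₅ (# 3))
                     refl x₂ x₃ x₄ x₅ y₂ y₄ y₅) (coordinate (# 3))
    , trans (solve 7 (λ x₂ x₃ x₄ x₅ y₂ y₄ y₅ → P.balance₃ x₂ x₃ x₄ x₅ y₂ y₄ y₅ := end x₂ x₃ x₄ x₅ y₂ y₄ y₅ (# 4))
                     refl x₂ x₃ x₄ x₅ y₂ y₄ y₅) (coordinate (# 4))
    , combination₃-≡0
        (solve 7 (λ x₂ x₃ x₄ x₅ y₂ y₄ y₅ →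
             y₂ :* (x₃ :- x₂) :* ((y₄ :- y₂) :* (x₅ :- x₄) :- y₂ :* (x₄ :- x₃))
          := con (+ 1) :* end x₂ x₃ x₄ x₅ y₂ y₄ y₅ (# 5) :+ (:- x₅) :* end x₂ x₃ x₄ x₅ y₂ y₄ y₅ (# 3)
             :+ (x₅ :* y₅) :* end x₂ x₃ x₄ x₅ y₂ y₄ y₅ (# 1)) refl x₂ x₃ x₄ x₅ y₂ y₄ y₅)
        (coordinate (# 5)) (coordinate (# 3)) (coordinate (# 1))
    where
    coordinate : ∀ k → lookup (lNext 0# (walkEnd x₂ x₃ x₄ x₅ y₂ 0# y₄ y₅)) k ≡ 0#
    coordinate k = trans (cong (λ v → lookup v k) closed) (lookup-replicate k 0#)
    end : ∀ {n} (x₂ x₃ x₄ x₅ y₂ y₄ y₅ : Polynomial n) → Fin 6 → Polynomial n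
    end x₂ x₃ x₄ x₅ y₂ y₄ y₅ = lookup (P.lNext (con (+ 0)) (P.walkEnd x₂ x₃ x₄ x₅ y₂ (con (+ 0)) y₄ y₅))

  closing-parameter : ∀ {x₃ x₄ x₅ y₂ y₄} → y₂ ≢ 0# → (y₄ - y₂) * (x₅ - x₄) - y₂ * (x₄ - x₃) ≡ 0# →
    Σ Carrier λ r → x₄ ≡ x₃ + (y₄ - y₂) * r × x₅ ≡ x₄ + y₂ * r
  closing-parameter {x₃} {x₄} {x₅} {y₂} {y₄} y₂≢0 e with inverse y₂ y₂≢0
  ... | y₂⁻¹ , y₂y₂⁻¹≡1 = r , x-y≡0⇒x≡y x₄≡ , x-y≡0⇒x≡y x₅≡
    where
    r : Carrier
    r = y₂⁻¹ * (x₅ - x₄)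
    x₅≡ : x₅ - (x₄ + y₂ * r) ≡ 0#
    x₅≡ = multiple-≡0
      (solve 4 (λ x₄ x₅ y₂ y₂⁻¹ → x₅ :- (x₄ :+ y₂ :* (y₂⁻¹ :* (x₅ :- x₄))) := (x₅ :- x₄) :* (con (+ 1) :- y₂ :* y₂⁻¹))
             refl x₄ x₅ y₂ y₂⁻¹)
      (x≡y⇒x-y≡0 (sym y₂y₂⁻¹≡1))
    x₄≡ : x₄ - (x₃ + (y₄ - y₂) * r) ≡ 0#
    x₄≡ = x*y≡0⇒y≡0 y₂≢0 (combination-≡0
      (solve 6 (λ x₃ x₄ x₅ y₂ y₄ y₂⁻¹ →
           y₂ :* (x₄ :- (x₃ :+ (y₄ :- y₂) :* (y₂⁻¹ :* (x₅ :- x₄))))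
        := (:- con (+ 1)) :* ((y₄ :- y₂) :* (x₅ :- x₄) :- y₂ :* (x₄ :- x₃))
           :+ (y₄ :- y₂) :* (x₅ :- (x₄ :+ y₂ :* (y₂⁻¹ :* (x₅ :- x₄))))) refl x₃ x₄ x₅ y₂ y₄ y₂⁻¹)
      e x₅≡)

  reduced-balance : ∀ {x₂ x₃ x₄ x₅ y₂ y₄ y₅} r → x₄ ≡ x₃ + (y₄ - y₂) * r → x₅ ≡ x₄ + y₂ * r → y₂ ≢ 0# →
    balance₁ x₂ x₃ x₄ x₅ y₂ y₄ y₅ ≡ 0# → balance₂ x₂ x₃ x₄ x₅ y₂ y₄ y₅ ≡ 0# → balance₃ x₂ x₃ x₄ x₅ y₂ y₄ y₅ ≡ 0# →
      (y₂ - y₅) * (y₄ * r + (x₃ - x₂)) + (y₄ - y₂) * (y₄ * r) ≡ 0#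
    × x₂ * (y₄ * r + (x₃ - x₂)) + (y₄ * r) * ((y₄ - y₂) * r) ≡ 0#
    × (y₂ - y₅) * (y₄ * r + (x₃ - x₂)) - y₅ * x₂ ≡ 0#
  reduced-balance {x₂} {x₃} {_} {_} {y₂} {y₄} {y₅} r refl refl y₂≢0 B₁ B₂ B₃ =
      x*y≡0⇒y≡0 y₂≢0 (combination-≡0
        (solve 6 (λ x₂ x₃ y₂ y₄ y₅ r → let x₄ = x₃ :+ (y₄ :- y₂) :* r ; x₅ = x₄ :+ y₂ :* r in
             y₂ :* ((y₂ :- y₅) :* (y₄ :* r :+ (x₃ :- x₂)) :+ (y₄ :- y₂) :* (y₄ :* r))
          := con (+ 1) :* P.balance₂ x₂ x₃ x₄ x₅ y₂ y₄ y₅ :+ (:- y₅) :* P.balance₁ x₂ x₃ x₄ x₅ y₂ y₄ y₅)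
          refl x₂ x₃ y₂ y₄ y₅ r) B₂ B₁)
    , x*y≡0⇒y≡0 y₂≢0 (combination-≡0
        (solve 6 (λ x₂ x₃ y₂ y₄ y₅ r → let x₄ = x₃ :+ (y₄ :- y₂) :* r ; x₅ = x₄ :+ y₂ :* r in
             y₂ :* (x₂ :* (y₄ :* r :+ (x₃ :- x₂)) :+ (y₄ :* r) :* ((y₄ :- y₂) :* r))
          := con (+ 1) :* P.balance₃ x₂ x₃ x₄ x₅ y₂ y₄ y₅ :+ (:- x₅) :* P.balance₁ x₂ x₃ x₄ x₅ y₂ y₄ y₅)
          refl x₂ x₃ y₂ y₄ y₅ r) B₃ B₁)
    , multiple-≡0
        (solve 6 (λ x₂ x₃ y₂ y₄ y₅ r → let x₄ = x₃ :+ (y₄ :- y₂) :* r ; x₅ = x₄ :+ y₂ :* r in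
             (y₂ :- y₅) :* (y₄ :* r :+ (x₃ :- x₂)) :- y₅ :* x₂ := con (+ 1) :* P.balance₁ x₂ x₃ x₄ x₅ y₂ y₄ y₅)
          refl x₂ x₃ y₂ y₄ y₅ r) B₁

  reduced-relations : ∀ {x₂ u₂ y₂ y₄ y₅ r} →
    (y₂ - y₅) * (y₄ * r + u₂) + (y₄ - y₂) * (y₄ * r) ≡ 0# →
    x₂ * (y₄ * r + u₂) + (y₄ * r) * ((y₄ - y₂) * r) ≡ 0# →
    (y₂ - y₅) * (y₄ * r + u₂) - y₅ * x₂ ≡ 0# →
    u₂ ≢ 0# → y₄ - y₂ ≢ 0# → y₂ - y₅ ≢ 0# →
    x₂ - (y₂ - y₅) * r ≡ 0# × y₄ * r + u₂ - y₅ * r ≡ 0#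
  reduced-relations {x₂} {u₂} {y₂} {y₄} {y₅} {r} A B C u₂≢0 y₄-y₂≢0 y₂-y₅≢0 = x₂≡ , T≡
    where
    T : Carrier
    T = y₄ * r + u₂
    T≢0 : T ≢ 0#
    T≢0 T≡0 = u₂≢0 (combination-≡0
      (solve 2 (λ y₄r u₂ → u₂ := con (+ 1) :* (y₄r :+ u₂) :+ (:- con (+ 1)) :* y₄r) refl (y₄ * r) u₂)
      T≡0 y₄r≡0)
      where
      y₄r≡0 : y₄ * r ≡ 0#
      y₄r≡0 = x*y≡0⇒y≡0 y₄-y₂≢0 (combination-≡0
        (solve 5 (λ y₂ y₄ y₅ y₄r u₂ →
             (y₄ :- y₂) :* y₄r
          := con (+ 1) :* ((y₂ :- y₅) :* (y₄r :+ u₂) :+ (y₄ :- y₂) :* y₄r) :+ (:- (y₂ :- y₅)) :* (y₄r :+ u₂))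
          refl y₂ y₄ y₅ (y₄ * r) u₂)
        A T≡0)
    x₂≡ : x₂ - (y₂ - y₅) * r ≡ 0#
    x₂≡ = x*y≡0⇒y≡0 T≢0 (combination-≡0
      (solve 6 (λ x₂ u₂ y₂ y₄ y₅ r → let T = y₄ :* r :+ u₂ in
           T :* (x₂ :- (y₂ :- y₅) :* r)
        := con (+ 1) :* (x₂ :* T :+ (y₄ :* r) :* ((y₄ :- y₂) :* r)) :+ (:- r) :* ((y₂ :- y₅) :* T :+ (y₄ :- y₂) :* (y₄ :* r)))
        refl x₂ u₂ y₂ y₄ y₅ r) B A)
    T≡ : T - y₅ * r ≡ 0#
    T≡ = x*y≡0⇒y≡0 y₂-y₅≢0 (combination-≡0
      (solve 5 (λ x₂ T y₂ y₅ r →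
           (y₂ :- y₅) :* (T :- y₅ :* r) := con (+ 1) :* ((y₂ :- y₅) :* T :- y₅ :* x₂) :+ y₅ :* (x₂ :- (y₂ :- y₅) :* r))
        refl x₂ T y₂ y₅ r) C x₂≡)

  reduced-solution : ∀ {x₂ u₂ y₂ y₄ y₅ r} →
    (y₂ - y₅) * (y₄ * r + u₂) + (y₄ - y₂) * (y₄ * r) ≡ 0# →
    x₂ - (y₂ - y₅) * r ≡ 0# → y₄ * r + u₂ - y₅ * r ≡ 0# → u₂ ≢ 0# →
    r ≢ 0# × y₅ ≡ y₂ - y₄ × x₂ ≡ y₄ * r × u₂ ≡ (y₂ - (y₄ + y₄)) * r
  reduced-solution {x₂} {u₂} {y₂} {y₄} {y₅} {r} A x₂≡ T≡ u₂≢0 =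
    r≢0 , x-y≡0⇒x≡y y₅≡ , x-y≡0⇒x≡y x₂≡y₄r , x-y≡0⇒x≡y u₂≡
    where
    r≢0 : r ≢ 0#
    r≢0 r≡0 = u₂≢0 (combination-≡0
      (solve 4 (λ u₂ y₄ y₅ r → u₂ := con (+ 1) :* (y₄ :* r :+ u₂ :- y₅ :* r) :+ (y₅ :- y₄) :* r) refl u₂ y₄ y₅ r)
      T≡ r≡0)
    y₅-y₄≢0 : y₅ - y₄ ≢ 0#
    y₅-y₄≢0 y₅-y₄≡0 = u₂≢0 (combination-≡0
      (solve 4 (λ u₂ y₄ y₅ r → u₂ := con (+ 1) :* (y₄ :* r :+ u₂ :- y₅ :* r) :+ r :* (y₅ :- y₄)) refl u₂ y₄ y₅ r)
      T≡ y₅-y₄≡0)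
    y₅≡ : y₅ - (y₂ - y₄) ≡ 0#
    y₅≡ = x*y≡0⇒y≡0 (x≢0∧y≢0⇒x*y≢0 r≢0 y₅-y₄≢0) (combination-≡0
      (solve 5 (λ u₂ y₂ y₄ y₅ r → let T = y₄ :* r :+ u₂ in
           r :* (y₅ :- y₄) :* (y₅ :- (y₂ :- y₄))
        := (:- con (+ 1)) :* ((y₂ :- y₅) :* T :+ (y₄ :- y₂) :* (y₄ :* r)) :+ (y₂ :- y₅) :* (T :- y₅ :* r))
        refl u₂ y₂ y₄ y₅ r) A T≡)
    x₂≡y₄r : x₂ - y₄ * r ≡ 0#
    x₂≡y₄r = combination-≡0
      (solve 5 (λ x₂ y₂ y₄ y₅ r → x₂ :- y₄ :* r := con (+ 1) :* (x₂ :- (y₂ :- y₅) :* r) :+ (:- r) :* (y₅ :- (y₂ :- y₄)))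
        refl x₂ y₂ y₄ y₅ r) x₂≡ y₅≡
    u₂≡ : u₂ - (y₂ - (y₄ + y₄)) * r ≡ 0#
    u₂≡ = combination-≡0
      (solve 5 (λ u₂ y₂ y₄ y₅ r →
           u₂ :- (y₂ :- (y₄ :+ y₄)) :* r := con (+ 1) :* (y₄ :* r :+ u₂ :- y₅ :* r) :+ r :* (y₅ :- (y₂ :- y₄)))
        refl u₂ y₂ y₄ y₅ r) T≡ y₅≡

  Canonical : (x₂ x₃ x₄ x₅ y₂ y₃ y₄ y₅ : Carrier) → Set
  Canonical x₂ x₃ x₄ x₅ y₂ y₃ y₄ y₅ = Σ Carrier λ b → Σ Carrier λ c → Σ Carrier λ r →
    b ≢ 0# × c ≢ 0# × r ≢ 0# × b ≢ - c × b ≢ - (c + c) ×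
    y₂ ≡ - b × y₃ ≡ 0# × y₄ ≡ c × y₅ ≡ - (b + c) ×
    x₂ ≡ c * r × x₃ ≡ - ((b + c) * r) × x₄ ≡ 0# × x₅ ≡ - (b * r)

  canonical-solution : ∀ {x₂ x₃ x₄ x₅ y₂ y₄ y₅} r →
    y₅ ≡ y₂ - y₄ → x₂ ≡ y₄ * r → x₃ ≡ x₂ + (y₂ - (y₄ + y₄)) * r → x₄ ≡ x₃ + (y₄ - y₂) * r → x₅ ≡ x₄ + y₂ * r →
    r ≢ 0# → y₂ ≢ 0# → x₃ - x₂ ≢ 0# → y₄ - y₂ ≢ 0# → y₂ - y₅ ≢ 0# → Canonical x₂ x₃ x₄ x₅ y₂ 0# y₄ y₅
  canonical-solution {y₂ = y₂} {y₄} r refl refl refl refl refl r≢0 y₂≢0 x₃-x₂≢0 y₄-y₂≢0 y₂-y₅≢0 =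
      - y₂ , y₄ , r
    , (λ -y₂≡0 → y₂≢0 (multiple-≡0 (solve 1 (λ y₂ → y₂ := (:- con (+ 1)) :* (:- y₂)) refl y₂) -y₂≡0))
    , (λ y₄≡0 → y₂-y₅≢0 (multiple-≡0 (solve 2 (λ y₂ y₄ → y₂ :- (y₂ :- y₄) := con (+ 1) :* y₄) refl y₂ y₄) y₄≡0))
    , r≢0
    , (λ e → y₄-y₂≢0 (multiple-≡0
        (solve 2 (λ y₂ y₄ → y₄ :- y₂ := con (+ 1) :* (:- y₂ :- (:- y₄))) refl y₂ y₄) (x≡y⇒x-y≡0 e)))
    , (λ e → x₃-x₂≢0 (multiple-≡0
        (solve 3 (λ y₂ y₄ r → y₄ :* r :+ (y₂ :- (y₄ :+ y₄)) :* r :- y₄ :* r := (:- r) :* (:- y₂ :- (:- (y₄ :+ y₄))))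
               refl y₂ y₄ r) (x≡y⇒x-y≡0 e)))
    , solve 1 (λ y₂ → y₂ := :- (:- y₂)) refl y₂
    , refl
    , refl
    , solve 2 (λ y₂ y₄ → y₂ :- y₄ := :- (:- y₂ :+ y₄)) refl y₂ y₄
    , refl
    , solve 3 (λ y₂ y₄ r → y₄ :* r :+ (y₂ :- (y₄ :+ y₄)) :* r := :- ((:- y₂ :+ y₄) :* r)) refl y₂ y₄ r
    , solve 3 (λ y₂ y₄ r → y₄ :* r :+ (y₂ :- (y₄ :+ y₄)) :* r :+ (y₄ :- y₂) :* r := con (+ 0)) refl y₂ y₄ r
    , solve 3 (λ y₂ y₄ r → y₄ :* r :+ (y₂ :- (y₄ :+ y₄)) :* r :+ (y₄ :- y₂) :* r :+ y₂ :* r := :- (:- y₂ :* r))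
            refl y₂ y₄ r

  closing-solution : ∀ {x₂ x₃ x₄ x₅ y₂ y₃ y₄ y₅} → y₃ ≡ 0# →
    lNext 0# (walkEnd x₂ x₃ x₄ x₅ y₂ y₃ y₄ y₅) ≡ origin → stepΔ x₃ y₃ (stepΔ x₂ y₂ origin) ≢ origin →
    (y₄ - y₂) * (y₂ - y₅) ≢ 0# → Canonical x₂ x₃ x₄ x₅ y₂ y₃ y₄ y₅
  closing-solution {x₂} {x₃} {y₂ = y₂} {y₄ = y₄} {y₅} refl closed r₃≢origin nondegenerate =
    let B₁ , B₂ , B₃ , B₄         = closing-balance closed
        r , x₄≡ , x₅≡             = closing-parameter y₂≢0 (x*y≡0⇒y≡0 D≢0 B₄)
        A , B , C                 = reduced-balance r x₄≡ x₅≡ y₂≢0 B₁ B₂ B₃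
        x₂-rel , T-rel            = reduced-relations A B C x₃-x₂≢0 y₄-y₂≢0 y₂-y₅≢0
        r≢0 , y₅≡ , x₂≡ , x₃-x₂≡ = reduced-solution A x₂-rel T-rel x₃-x₂≢0
    in canonical-solution r y₅≡ x₂≡ (x-y≡z⇒x≡y+z x₃-x₂≡) x₄≡ x₅≡ r≢0 y₂≢0 x₃-x₂≢0 y₄-y₂≢0 y₂-y₅≢0
    where
    D≢0 : y₂ * (x₃ - x₂) ≢ 0#
    D≢0 D≡0 = r₃≢origin (returns-to-origin D≡0)
    y₂≢0 : y₂ ≢ 0#
    y₂≢0 = x*y≢0⇒x≢0 D≢0
    x₃-x₂≢0 : x₃ - x₂ ≢ 0#
    x₃-x₂≢0 = x*y≢0⇒y≢0 D≢0
    y₄-y₂≢0 : y₄ - y₂ ≢ 0#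
    y₄-y₂≢0 = x*y≢0⇒x≢0 nondegenerate
    y₂-y₅≢0 : y₂ - y₅ ≢ 0#
    y₂-y₅≢0 = x*y≢0⇒y≢0 nondegenerate

  canonical⇒parametrised : ∀ {x₂ x₃ x₄ x₅ y₂ y₃ y₄ y₅} → Canonical x₂ x₃ x₄ x₅ y₂ y₃ y₄ y₅ →
    Parametrised (increments (lookup (0# ∷ x₂ ∷ x₃ ∷ x₄ ∷ x₅ ∷ [])))
                 (increments (lookup (0# ∷ y₂ ∷ y₃ ∷ y₄ ∷ y₅ ∷ [])))
  canonical⇒parametrised (b , c , r , b≢0 , c≢0 , r≢0 , b≢-c , b≢-2c , refl , refl , refl , refl , refl , refl , refl , refl) =
    b , c , r , b≢0 , c≢0 , r≢0 , b≢-c , b≢-2c , canonical-type b c r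

  closed-walk-type : ∀ {x₁ x₂ x₃ x₄ x₅ y₁ y₂ y₃ y₄ y₅} →
    let u = increments (lookup (x₁ ∷ x₂ ∷ x₃ ∷ x₄ ∷ x₅ ∷ []))
        v = increments (lookup (y₁ ∷ y₂ ∷ y₃ ∷ y₄ ∷ y₅ ∷ [])) in
    x₁ ≡ 0# → y₁ ≡ 0# →
    lNext x₁ (walkEnd x₂ x₃ x₄ x₅ y₂ y₃ y₄ y₅) ≡ origin → stepΔ x₃ y₃ (stepΔ x₂ y₂ origin) ≢ origin →
    v (# 0) + v (# 1) ≡ 0# → (v (# 1) + v (# 2)) * (v (# 0) + v (# 4)) ≢ 0# →
    Parametrised u v
  closed-walk-type {y₂ = y₂} {y₃} {y₄} {y₅} refl refl closed r₃≢origin v₀+v₁≡0 v-nondegenerate =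
    canonical⇒parametrised (closing-solution y₃≡0 closed r₃≢origin nondegenerate)
    where
    y₃≡0 : y₃ ≡ 0#
    y₃≡0 = multiple-≡0 (solve 2 (λ y₂ y₃ → y₃ := con (+ 1) :* ((y₂ :- con (+ 0)) :+ (y₃ :- y₂))) refl y₂ y₃) v₀+v₁≡0
    nondegenerate : (y₄ - y₂) * (y₂ - y₅) ≢ 0#
    nondegenerate e = v-nondegenerate (trans
      (solve 4 (λ y₂ y₃ y₄ y₅ → ((y₃ :- y₂) :+ (y₄ :- y₃)) :* ((y₂ :- con (+ 0)) :+ (con (+ 0) :- y₅)) := (y₄ :- y₂) :* (y₂ :- y₅))
             refl y₂ y₃ y₄ y₅) e)

  module CycleWalk {n} (C : Cycle 5 (ℕ.suc n)) where
    open Cycle C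

    starts-at-origin : ls zero ≡ origin × rs zero ≡ origin
    starts-at-origin with first-zero
    ... | zero , _ , ls₀≡origin , rs₀≡origin = ls₀≡origin , rs₀≡origin

    closes-at-origin : ls zero ≡ lNext (x zero) (rs (fromℕ n))
    closes-at-origin = adj⇒lNext (ls-L zero) (adj-rl zero)

    rs≡stepΔ : ∀ i → rs (suc i) ≡ stepΔ (x (suc i)) (y (suc i)) (rs (inject₁ i))
    rs≡stepΔ i = begin
      rs (suc i)                                    ≡⟨ adj⇒rNext (rs-R (suc i)) (adj-lr (suc i)) ⟩
      rNext (y (suc i)) (ls (suc i))                ≡⟨ cong (rNext _) (adj⇒lNext (ls-L (suc i)) (adj-rl (suc i))) ⟩
      step (x (suc i)) (y (suc i)) (rs (inject₁ i)) ≡⟨ step≡stepΔ _ _ _ ⟩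
      stepΔ (x (suc i)) (y (suc i)) (rs (inject₁ i)) ∎

  cycle-type : (C : Cycle 5 5) → let open Cycle C in
    v (# 0) + v (# 1) ≡ 0# → (v (# 1) + v (# 2)) * (v (# 0) + v (# 4)) ≢ 0# → Parametrised u v
  cycle-type C = closed-walk-type (cong (λ l → lookup l zero) ls₀≡origin) (cong (λ r → lookup r zero) rs₀≡origin)
    closes r₃≢origin
    where
    open Cycle C
    open CycleWalk C
    ls₀≡origin : ls zero ≡ origin
    ls₀≡origin = proj₁ starts-at-origin
    rs₀≡origin : rs zero ≡ origin
    rs₀≡origin = proj₂ starts-at-origin
    rs₂≡ : rs (# 2) ≡ stepΔ (x (# 2)) (y (# 2)) (stepΔ (x (# 1)) (y (# 1)) origin)
    rs₂≡ = trans (rs≡stepΔ (# 1)) (cong (stepΔ _ _) (trans (rs≡stepΔ (# 0)) (cong (stepΔ _ _) rs₀≡origin)))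
    rs₄≡ : rs (# 4) ≡ walkEnd (x (# 1)) (x (# 2)) (x (# 3)) (x (# 4)) (y (# 1)) (y (# 2)) (y (# 3)) (y (# 4))
    rs₄≡ = trans (rs≡stepΔ (# 3)) (cong (stepΔ _ _) (trans (rs≡stepΔ (# 2)) (cong (stepΔ _ _) rs₂≡)))
    closes : lNext (x (# 0)) (walkEnd (x (# 1)) (x (# 2)) (x (# 3)) (x (# 4)) (y (# 1)) (y (# 2)) (y (# 3)) (y (# 4))) ≡ origin
    closes = trans (cong (lNext _) (sym rs₄≡)) (trans (sym closes-at-origin) ls₀≡origin)
    r₃≢origin : stepΔ (x (# 2)) (y (# 2)) (stepΔ (x (# 1)) (y (# 1)) origin) ≢ origin
    r₃≢origin r₃≡origin with rs-distinct (# 2) (# 0) (trans rs₂≡ (trans r₃≡origin (sym rs₀≡origin)))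
    ... | ()

  cycle⇒parametrised : ∀ u v → HasCycleOfType 5 5 u v →
    (v (# 1) + v (# 2)) * (v (# 0) + v (# 4)) ≢ 0# → v (# 0) + v (# 1) ≡ 0# → Parametrised u v
  cycle⇒parametrised u v (C , C-u≗u , C-v≗v) nondegenerate v₀+v₁≡0 =
    Parametrised-resp C-u≗u C-v≗v (cycle-type C
      (trans (cong₂ _+_ (C-v≗v (# 0)) (C-v≗v (# 1))) v₀+v₁≡0)
      (λ e → nondegenerate (trans (sym (cong₂ _*_ (cong₂ _+_ (C-v≗v (# 1)) (C-v≗v (# 2)))
                                                   (cong₂ _+_ (C-v≗v (# 0)) (C-v≗v (# 4))))) e)))

  canonical-closing : ∀ b c r → let x = xs° b c r ; y = ys° b c in
    lNext 0# (walkEnd (x (# 1)) (x (# 2)) (x (# 3)) (x (# 4)) (y (# 1)) (y (# 2)) (y (# 3)) (y (# 4))) ≡ origin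
  canonical-closing b c r = Pointwise-≡⇒≡ (refl ∷
      solve 3 (λ b c r → closing b c r (# 1) := con (+ 0)) refl b c r
    ∷ solve 3 (λ b c r → closing b c r (# 2) := con (+ 0)) refl b c r
    ∷ solve 3 (λ b c r → closing b c r (# 3) := con (+ 0)) refl b c r
    ∷ solve 3 (λ b c r → closing b c r (# 4) := con (+ 0)) refl b c r
    ∷ solve 3 (λ b c r → closing b c r (# 5) := con (+ 0)) refl b c r
    ∷ [])
    where
    closing : ∀ {n} (b c r : Polynomial n) → Fin 6 → Polynomial n
    closing b c r = let x = P.xs° b c r ; y = P.ys° b c in
      lookup (P.lNext (con (+ 0)) (P.walkEnd (x (# 1)) (x (# 2)) (x (# 3)) (x (# 4)) (y (# 1)) (y (# 2)) (y (# 3)) (y (# 4))))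

  module CanonicalCycle {b c r : Carrier}
    (b≢0 : b ≢ 0#) (c≢0 : c ≢ 0#) (r≢0 : r ≢ 0#) (b≢-c : b ≢ - c) (b≢-2c : b ≢ - (c + c)) where

    private
      ls rs : Fin 5 → Vect 5
      ls = ls° b c r
      rs = rs° b c r
      cr≢0 : c * r ≢ 0#
      cr≢0 = x≢0∧y≢0⇒x*y≢0 c≢0 r≢0
      br≢0 : b * r ≢ 0#
      br≢0 = x≢0∧y≢0⇒x*y≢0 b≢0 r≢0
      b+c≢0 : b + c ≢ 0#
      b+c≢0 = x≢-y⇒x+y≢0 b≢-c
      b+2c≢0 : b + (c + c) ≢ 0#
      b+2c≢0 = x≢-y⇒x+y≢0 b≢-2c
      [b+c]r≢0 : (b + c) * r ≢ 0#
      [b+c]r≢0 = x≢0∧y≢0⇒x*y≢0 b+c≢0 r≢0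
      [b+2c]r≢0 : (b + (c + c)) * r ≢ 0#
      [b+2c]r≢0 = x≢0∧y≢0⇒x*y≢0 b+2c≢0 r≢0
      b[b+2c]r≢0 : b * ((b + (c + c)) * r) ≢ 0#
      b[b+2c]r≢0 = x≢0∧y≢0⇒x*y≢0 b≢0 [b+2c]r≢0

    ls-distinct : ∀ i j → ls i ≡ ls j → i ≡ j
    ls-distinct = injective-cons ls new₀ (injective-cons (λ i → ls (suc i)) new₁
      (injective-cons (λ i → ls (suc (suc i))) new₂ (injective-cons (λ i → ls (suc (suc (suc i)))) new₃
      λ { zero zero _ → refl })))
      where
      new₀ : ∀ j → ls zero ≢ ls (suc j)
      new₀ zero = differ-at (# 0) (solve 3 (λ b c r → P.xs° b c r (# 1) :- con (+ 0) := c :* r) refl b c r) cr≢0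
      new₀ (suc zero) = differ-at (# 0)
        (solve 3 (λ b c r → P.xs° b c r (# 2) :- con (+ 0) := :- ((b :+ c) :* r)) refl b c r) (-x≢0 [b+c]r≢0)
      new₀ (suc (suc zero)) = differ-at (# 1)
        (solve 3 (λ b c r → lookup (P.ls° b c r (# 3)) (# 1) :- con (+ 0) := b :* ((b :+ (c :+ c)) :* r)) refl b c r)
        b[b+2c]r≢0
      new₀ (suc (suc (suc zero))) = differ-at (# 0)
        (solve 3 (λ b c r → P.xs° b c r (# 4) :- con (+ 0) := :- (b :* r)) refl b c r) (-x≢0 br≢0)
      new₁ : ∀ j → ls (# 1) ≢ ls (suc (suc j))
      new₁ zero = differ-at (# 0)
        (solve 3 (λ b c r → P.xs° b c r (# 2) :- P.xs° b c r (# 1) := :- ((b :+ (c :+ c)) :* r)) refl b c r)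
        (-x≢0 [b+2c]r≢0)
      new₁ (suc zero) = differ-at (# 0)
        (solve 3 (λ b c r → P.xs° b c r (# 3) :- P.xs° b c r (# 1) := :- (c :* r)) refl b c r) (-x≢0 cr≢0)
      new₁ (suc (suc zero)) = differ-at (# 0)
        (solve 3 (λ b c r → P.xs° b c r (# 4) :- P.xs° b c r (# 1) := :- ((b :+ c) :* r)) refl b c r)
        (-x≢0 [b+c]r≢0)
      new₂ : ∀ j → ls (# 2) ≢ ls (suc (suc (suc j)))
      new₂ zero = differ-at (# 0)
        (solve 3 (λ b c r → P.xs° b c r (# 3) :- P.xs° b c r (# 2) := (b :+ c) :* r) refl b c r) [b+c]r≢0
      new₂ (suc zero) = differ-at (# 0)
        (solve 3 (λ b c r → P.xs° b c r (# 4) :- P.xs° b c r (# 2) := c :* r) refl b c r) cr≢0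
      new₃ : ∀ j → ls (# 3) ≢ ls (suc (suc (suc (suc j))))
      new₃ zero = differ-at (# 0)
        (solve 3 (λ b c r → P.xs° b c r (# 4) :- P.xs° b c r (# 3) := :- (b :* r)) refl b c r) (-x≢0 br≢0)

    rs-distinct : ∀ i j → rs i ≡ rs j → i ≡ j
    rs-distinct = injective-cons rs new₀ (injective-cons (λ i → rs (suc i)) new₁
      (injective-cons (λ i → rs (suc (suc i))) new₂ (injective-cons (λ i → rs (suc (suc (suc i)))) new₃
      λ { zero zero _ → refl })))
      where
      new₀ : ∀ j → rs zero ≢ rs (suc j)
      new₀ zero = differ-at (# 0) (solve 2 (λ b c → P.ys° b c (# 1) :- con (+ 0) := :- b) refl b c) (-x≢0 b≢0)
      new₀ (suc zero) = differ-at (# 2)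
        (solve 3 (λ b c r → lookup (P.rs° b c r (# 2)) (# 2) :- con (+ 0) := :- (b :* ((b :+ (c :+ c)) :* r))) refl b c r)
        (-x≢0 b[b+2c]r≢0)
      new₀ (suc (suc zero)) = differ-at (# 0) (solve 2 (λ b c → P.ys° b c (# 3) :- con (+ 0) := c) refl b c) c≢0
      new₀ (suc (suc (suc zero))) = differ-at (# 0)
        (solve 2 (λ b c → P.ys° b c (# 4) :- con (+ 0) := :- (b :+ c)) refl b c) (-x≢0 b+c≢0)
      new₁ : ∀ j → rs (# 1) ≢ rs (suc (suc j))
      new₁ zero = differ-at (# 0) (solve 2 (λ b c → P.ys° b c (# 2) :- P.ys° b c (# 1) := b) refl b c) b≢0
      new₁ (suc zero) = differ-at (# 0)
        (solve 2 (λ b c → P.ys° b c (# 3) :- P.ys° b c (# 1) := b :+ c) refl b c) b+c≢0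
      new₁ (suc (suc zero)) = differ-at (# 0)
        (solve 2 (λ b c → P.ys° b c (# 4) :- P.ys° b c (# 1) := :- c) refl b c) (-x≢0 c≢0)
      new₂ : ∀ j → rs (# 2) ≢ rs (suc (suc (suc j)))
      new₂ zero = differ-at (# 0) (solve 2 (λ b c → P.ys° b c (# 3) :- P.ys° b c (# 2) := c) refl b c) c≢0
      new₂ (suc zero) = differ-at (# 0)
        (solve 2 (λ b c → P.ys° b c (# 4) :- P.ys° b c (# 2) := :- (b :+ c)) refl b c) (-x≢0 b+c≢0)
      new₃ : ∀ j → rs (# 3) ≢ rs (suc (suc (suc (suc j))))
      new₃ zero = differ-at (# 0)
        (solve 2 (λ b c → P.ys° b c (# 4) :- P.ys° b c (# 3) := :- (b :+ (c :+ c))) refl b c) (-x≢0 b+2c≢0)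

    -- The index is matched rather than written as prevIdx zero: converting between the two
    -- directly makes Agda unfold the whole walk.
    closes : ∀ {i} → i ≡ # 4 → Adj (ls zero) (rs i)
    closes refl = subst (λ l → Adj l (rs (# 4)))
      (trans (cong (lNext 0#) (steps≡walkEnd _ _ _ _ _ _ _ _)) (canonical-closing b c r))
      (adj-lNext 0# (rs (# 4)))

    cycle : Cycle 5 5
    cycle = record
      { ls = ls ; rs = rs
      ; ls-L = λ { zero → origin-L ; (suc i) → lNext-L (xs° b c r (suc i)) (rs (inject₁ i)) }
      ; rs-R = λ { zero → origin-R
                 ; i@(suc zero) → rNext-R (ys° b c i) (ls i) ; i@(suc (suc zero)) → rNext-R (ys° b c i) (ls i)
                 ; i@(suc (suc (suc zero))) → rNext-R (ys° b c i) (ls i)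
                 ; i@(suc (suc (suc (suc zero)))) → rNext-R (ys° b c i) (ls i) }
      ; ls-distinct = ls-distinct ; rs-distinct = rs-distinct
      ; adj-lr = λ { zero → adj-origin
                   ; i@(suc zero) → adj-rNext (ys° b c i) (ls i) ; i@(suc (suc zero)) → adj-rNext (ys° b c i) (ls i)
                   ; i@(suc (suc (suc zero))) → adj-rNext (ys° b c i) (ls i)
                   ; i@(suc (suc (suc (suc zero)))) → adj-rNext (ys° b c i) (ls i) }
      ; adj-rl = λ { zero → closes {prevIdx zero} refl ; (suc i) → adj-lNext (xs° b c r (suc i)) (rs (inject₁ i)) }
      ; first-zero = zero , refl , refl , refl
      }

    type : ParametrisedBy b c r (Cycle.u cycle) (Cycle.v cycle)
    type = canonical-type b c r

  parametrised⇒cycle : ∀ u v → Parametrised u v →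
    HasCycleOfType 5 5 u v × (v (# 1) + v (# 2)) * (v (# 0) + v (# 4)) ≢ 0# × v (# 0) + v (# 1) ≡ 0#
  parametrised⇒cycle u v (b , c , r , b≢0 , c≢0 , r≢0 , b≢-c , b≢-2c , P@(v₀ , v₁ , v₂ , _ , v₄ , _)) =
      (cycle , ParametrisedBy-unique type P)
    , (λ e → x≢0∧y≢0⇒x*y≢0 (x≢-y⇒x+y≢0 b≢-c) c≢0 (trans
         (solve 2 (λ b c → (b :+ c) :* c := (b :+ c) :* (:- b :+ (b :+ c))) refl b c)
         (trans (sym (cong₂ _*_ (cong₂ _+_ v₁ v₂) (cong₂ _+_ v₀ v₄))) e)))
    , trans (cong₂ _+_ v₀ v₁) (solve 1 (λ b → :- b :+ b := con (+ 0)) refl b)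
    where open CanonicalCycle b≢0 c≢0 r≢0 b≢-c b≢-2c

lemma3 : (F : FiniteField) → let open FiniteField F in let open Lambda F in
    (u v : Fin 5 → Carrier) →
    (HasCycleOfType 5 5 u v
      × (v (# 1) + v (# 2)) * (v (# 0) + v (# 4)) ≢ 0#
      × v (# 0) + v (# 1) ≡ 0#)
    ⇔
    Σ Carrier (λ b → Σ Carrier (λ c → Σ Carrier (λ r →
      b ≢ 0# × c ≢ 0# × r ≢ 0#
      × b ≢ - c × b ≢ - (c + c)
      × v (# 0) ≡ - b × v (# 1) ≡ b × v (# 2) ≡ c
      × v (# 3) ≡ - b - (c + c) × v (# 4) ≡ b + c
      × u (# 0) ≡ c * r × u (# 1) ≡ - ((b + (c + c)) * r)
      × u (# 2) ≡ (b + c) * r × u (# 3) ≡ - (b * r) × u (# 4) ≡ b * r)))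
lemma3 F u v = mk⇔ (λ (has-cycle , nondegenerate , v₀+v₁≡0) → cycle⇒parametrised u v has-cycle nondegenerate v₀+v₁≡0)
                   (parametrised⇒cycle u v)
  where open Λ₅ F
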